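{- Let $n = 4k$ for a positive integer $k$. Then there exists a feasible single round robin schedule for the $n$ teams $1,\dots,n$ that is single-break (hence minimum-break) and ranking-fair.
   Context: Teams are $T=\{1,\dots,n\}$ ($n$ even), ranked by strength: team $i$ is stronger than team $j$ iff $i<j$. Rounds are $R=\{1,\dots,n-1\}$. A schedule assigns to each unordered pair $\{i,j\}$ of distinct teams a round in $R$ in which they play, and designates which of the two plays at home (the other plays away). A schedule is feasible if every team plays exactly one game in every round. The ranking HAP of team $i$ is the vector $(p_1,\dots,p_{n-1})$ with $p_m\in\{H,A\}$ indicating whether team $i$ plays home or away against its $m$-th strongest opponent (opponents listed in increasing order of index). A schedule is ranking-fair if the ranking HAP of every team alternates between $H$ and $A$ (no two consecutive entries equal). The home-away pattern (HAP) of a team is $(h_1,\dots,h_{n-1})$ with $h_r\in\{H,A\}$ its venue in round $r$; HAPs are read cyclically, with $h_0:=h_{n-1}$, and a team has a break in round $r$ if $h_{r-1}=h_r$. Since $n-1$ is odd, every HAP has at least one break; a schedule is single-break if every team's HAP has exactly one break, which minimizes the number of breaks. -}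

module Defs where

open import Data.Nat using (ℕ; zero; suc; _∸_; _*_; _≤_; _<_)
open import Data.Fin using (Fin; toℕ)
open import Data.Fin.Properties using () renaming (_≟_ to _≟ᶠ_)
open import Data.Bool using (Bool; true; false; not; _∧_; if_then_else_)
open import Data.List using (List; []; _∷_; map; filterᵇ; allFin)
open import Data.Bool.ListAction using (any)
open import Data.Unit using (⊤)
open import Data.Nat using (_≡ᵇ_)
open import Data.Product using (Σ; _×_; _,_)
open import Relation.Binary.PropositionalEquality using (_≡_; _≢_)
open import Relation.Nullary.Decidable using (⌊_⌋)

-- Teams are Fin n : team index 0 is the strongest (paper's team 1), i.e.
-- team i is stronger than team j iff toℕ i < toℕ j.
-- Rounds are Fin (n ∸ 1) : index t is the paper's round t+1.
-- A (candidate) schedule assigns to every ordered pair a round and a venue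
-- flag; the well-formedness conditions below make this an assignment on
-- unordered pairs with exactly one home team.
record Schedule (n : ℕ) : Set where
  field
    round : Fin n → Fin n → Fin (n ∸ 1)
    -- home i j ≡ true  iff  team i plays at home in its game against j
    home  : Fin n → Fin n → Bool

open Schedule public

WellFormed : {n : ℕ} → Schedule n → Set
WellFormed {n} s =
  (i j : Fin n) → i ≢ j →
    (round s i j ≡ round s j i) × (home s j i ≡ not (home s i j))

Feasible : {n : ℕ} → Schedule n → Set
Feasible {n} s =
  (i : Fin n) (r : Fin (n ∸ 1)) →
    Σ (Fin n) (λ j → (j ≢ i) × (round s i j ≡ r))
    × ((j j′ : Fin n) → j ≢ i → j′ ≢ i → round s i j ≡ r → round s i j′ ≡ r → j ≡ j′)

rankingHAP : {n : ℕ} → Schedule n → Fin n → List Bool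
rankingHAP {n} s i =
  map (home s i) (filterᵇ (λ j → not ⌊ j ≟ᶠ i ⌋) (allFin n))

Alternating : List Bool → Set
Alternating []            = ⊤
Alternating (x ∷ [])      = ⊤
Alternating (x ∷ y ∷ xs)  = (x ≢ y) × Alternating (y ∷ xs)

RankingFair : {n : ℕ} → Schedule n → Set
RankingFair {n} s = (i : Fin n) → Alternating (rankingHAP s i)

-- venue of team i in the round with (0-based) index t : true = H
-- (i plays home against the opponent j it meets in round t)
venue : {n : ℕ} → Schedule n → Fin n → ℕ → Bool
venue {n} s i t =
  any (λ j → not ⌊ j ≟ᶠ i ⌋ ∧ (toℕ (round s i j) ≡ᵇ t) ∧ home s i j) (allFin n)

cycPred : ℕ → ℕ → ℕ
cycPred m zero    = m ∸ 1
cycPred m (suc t) = t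

Break : {n : ℕ} → Schedule n → Fin n → Fin (n ∸ 1) → Set
Break {n} s i r = venue s i (cycPred (n ∸ 1) (toℕ r)) ≡ venue s i (toℕ r)

SingleBreak : {n : ℕ} → Schedule n → Set
SingleBreak {n} s =
  (i : Fin n) →
    Σ (Fin (n ∸ 1)) (λ r → Break s i r × ((r′ : Fin (n ∸ 1)) → Break s i r′ → r′ ≡ r))

-- Write team x = 2P + μ as member μ ∈ {0, 1} of the super-team P ≤ 2K + 1, where n = 4(K + 1),
-- and let m = 4K + 3 be the number of rounds.  Ranking-fairness comes from the orientation
-- hosts x y = (x < y) xor (x + y even), which alternates along the opponents of x in rank order.
-- Rounds are assigned modulo m in the manner of the circle method: members μ of P and ν of Q ≠ P
-- meet in round 2P + 2Q + (μ xor ν).  The exceptions are the partners 2P and 2P + 1, who meet in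
-- round 4P + [P ≤ K], and the games of the last super-team 2K + 1 (the apex) against members of
-- P of the other parity, which are moved to round 4P + [K < P].  Counted from round 2P, a team
-- meets its opponents in distinct slots from which the opponent can be read back, so it plays
-- exactly once per round, and its venue in slot w is (w even) xor (b ≤ w) for an explicit b:
-- an alternating pattern with a single break.

module Submission where

open import Data.Bool using (Bool; true; false; not; _xor_; _∧_; if_then_else_; T)
  renaming (_≟_ to _≟ᵇ_)
open import Data.Bool.ListAction using (any)
open import Data.Bool.Properties
  using (not-involutive; not-¬; ¬-not; T-≡; T-∧; ∧-zeroʳ; xor-comm; xor-assoc; xor-same; xor-identityʳ;
         xor-inverseʳ; not-distribˡ-xor; not-distribʳ-xor; xor-annihilates-not)
open import Data.Fin using (Fin; toℕ; fromℕ<; punchIn; punchOut) renaming (zero to fzero; suc to fsuc)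
open import Data.Fin.Properties
  using (toℕ-injective; toℕ-fromℕ<; toℕ<n; punchIn-injective; punchInᵢ≢i; punchOut-injective; pigeonhole; any?)
  renaming (_≟_ to _≟ᶠ_; <⇒≢ to <⇒≢ᶠ)
open import Data.List using ([]; _∷_; map; filterᵇ; tabulate; allFin)
open import Data.List.Membership.Propositional using (_∈_)
open import Data.List.Membership.Propositional.Properties using (∈-allFin)
open import Data.List.Properties using (map-cong)
open import Data.List.Relation.Unary.Any as Any using ()
open import Data.List.Relation.Unary.Any.Properties using (any⁺; any⁻)
open import Data.Nat
  using (ℕ; zero; suc; pred; _+_; _*_; _∸_; _≤_; _<_; _≤ᵇ_; _<ᵇ_; _≡ᵇ_; _≟_; _≤?_; ⌊_/2⌋;
         z≤n; s≤s; z<s; NonZero; >-nonZero; >-nonZero⁻¹)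
open import Data.Nat.DivMod using (_%_; m%n<n; m<n⇒m%n≡m; n%n≡0; m%n%n≡m%n; [m+n]%n≡m%n; %-distribˡ-+)
open import Data.Nat.Properties
open import Algebra.Properties.CommutativeSemigroup +-commutativeSemigroup using (x∙yz≈y∙xz)
open import Data.Nat.Tactic.RingSolver using (solve; solve-∀)
open import Data.Product using (Σ; _×_; _,_; proj₁; proj₂; uncurry)
open import Data.Sum using (_⊎_; inj₁; inj₂)
open import Data.Unit using (tt)
open import Function using (_∘_)
open import Function.Bundles using (Equivalence; _⇔_; mk⇔)
open import Function.Definitions using (Injective)
open import Relation.Binary using (tri<; tri≈; tri>)
open import Relation.Binary.PropositionalEquality
open import Relation.Nullary using (¬_; Dec; yes; no; contradiction)
open import Relation.Nullary.Decidable using (⌊_⌋; toWitnessFalse)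

open import Defs

-- Parity, and teams as members of super-teams

even : ℕ → Bool
even zero    = true
even (suc n) = not (even n)

odd : ℕ → Bool
odd n = not (even n)

bit : Bool → ℕ
bit false = 0
bit true  = 1

bit≤1 : ∀ b → bit b ≤ 1
bit≤1 false = z≤n
bit≤1 true  = s≤s z≤n

xor-≢ : ∀ {μ ν} → μ ≢ ν → μ xor ν ≡ true
xor-≢ {μ} μ≢ν = trans (cong (μ xor_) (¬-not (μ≢ν ∘ sym))) (xor-inverseʳ μ)

T⇒≡true : ∀ {b} → T b → b ≡ true
T⇒≡true = Equivalence.to T-≡

¬T⇒≡false : ∀ {b} → ¬ T b → b ≡ false
¬T⇒≡false {false} _  = refl
¬T⇒≡false {true}  ¬t = contradiction tt ¬t

<ᵇ-true : ∀ {m n} → m < n → (m <ᵇ n) ≡ true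
<ᵇ-true m<n = T⇒≡true (<⇒<ᵇ m<n)

<ᵇ-false : ∀ {m n} → n ≤ m → (m <ᵇ n) ≡ false
<ᵇ-false {m} {n} n≤m = ¬T⇒≡false (λ t → ≤⇒≯ n≤m (<ᵇ⇒< m n t))

≤ᵇ-true : ∀ {m n} → m ≤ n → (m ≤ᵇ n) ≡ true
≤ᵇ-true m≤n = T⇒≡true (≤⇒≤ᵇ m≤n)

≤ᵇ-false : ∀ {m n} → n < m → (m ≤ᵇ n) ≡ false
≤ᵇ-false {m} {n} n<m = ¬T⇒≡false (λ t → <⇒≱ n<m (≤ᵇ⇒≤ m n t))

≡ᵇ-true : ∀ {m n} → m ≡ n → (m ≡ᵇ n) ≡ true
≡ᵇ-true {m} {n} m≡n = T⇒≡true (≡⇒≡ᵇ m n m≡n)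

≡ᵇ-false : ∀ {m n} → m ≢ n → (m ≡ᵇ n) ≡ false
≡ᵇ-false {m} {n} m≢n = ¬T⇒≡false (λ t → m≢n (≡ᵇ⇒≡ m n t))

⌊⌋-false : ∀ {A : Set} (a? : Dec A) → ¬ A → ⌊ a? ⌋ ≡ false
⌊⌋-false (yes a) ¬a = contradiction a ¬a
⌊⌋-false (no _)  _  = refl

even-+ : ∀ m n → even (m + n) ≡ not (even m xor even n)
even-+ zero    n = sym (not-involutive (even n))
even-+ (suc m) n = begin
  not (even (m + n))                ≡⟨ cong not (even-+ m n) ⟩
  not (not (even m xor even n))     ≡⟨ cong not (not-distribˡ-xor (even m) (even n)) ⟩
  not (not (even m) xor even n)     ∎
  where open ≡-Reasoning

even-2* : ∀ n → even (2 * n) ≡ true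
even-2* zero    = refl
even-2* (suc n) rewrite +-suc n (n + 0) | even-2* n = refl

even-2*+bit : ∀ n b → even (2 * n + bit b) ≡ not b
even-2*+bit n false rewrite +-identityʳ (2 * n) = even-2* n
even-2*+bit n true  rewrite +-comm (2 * n) 1 = cong not (even-2* n)

2*+2≡2*suc : ∀ n → 2 * n + 2 ≡ 2 * suc n
2*+2≡2*suc = solve-∀

team : ℕ → Bool → ℕ
team P μ = 2 * P + bit μ

team-suc : ∀ P μ → team (suc P) μ ≡ suc (suc (team P μ))
team-suc P μ = cong (_+ bit μ) (+-suc (suc P) (P + 0))

⌊team/2⌋ : ∀ P μ → ⌊ team P μ /2⌋ ≡ P
⌊team/2⌋ zero    false = refl
⌊team/2⌋ zero    true  = refl
⌊team/2⌋ (suc P) μ rewrite team-suc P μ = cong suc (⌊team/2⌋ P μ)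

odd-team : ∀ P μ → odd (team P μ) ≡ μ
odd-team P μ = trans (cong not (even-2*+bit P μ)) (not-involutive μ)

team-⌊/2⌋ : ∀ x → team ⌊ x /2⌋ (odd x) ≡ x
team-⌊/2⌋ zero          = refl
team-⌊/2⌋ (suc zero)    = refl
team-⌊/2⌋ (suc (suc x)) rewrite not-involutive (even x) | team-suc ⌊ x /2⌋ (odd x) = cong (suc ∘ suc) (team-⌊/2⌋ x)

team-injectiveʳ : ∀ P {μ ν} → team P μ ≡ team P ν → μ ≡ ν
team-injectiveʳ P {μ} {ν} eq = trans (sym (odd-team P μ)) (trans (cong odd eq) (odd-team P ν))

team-false<team-true : ∀ P → team P false < team P true
team-false<team-true P = +-monoʳ-< (2 * P) (n<1+n 0)

team-< : ∀ {P Q} μ ν → P < Q → team P μ < team Q ν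
team-< {P} {Q} μ ν P<Q = begin-strict
  2 * P + bit μ    ≤⟨ +-monoʳ-≤ (2 * P) (bit≤1 μ) ⟩
  2 * P + 1        <⟨ +-monoʳ-< (2 * P) (n<1+n 1) ⟩
  2 * P + 2        ≡⟨ 2*+2≡2*suc P ⟩
  2 * suc P        ≤⟨ *-monoʳ-≤ 2 P<Q ⟩
  2 * Q            ≤⟨ m≤m+n (2 * Q) (bit ν) ⟩
  2 * Q + bit ν    ∎
  where open ≤-Reasoning

team-<ᵇ : ∀ {P Q} μ ν → Q ≢ P → (team P μ <ᵇ team Q ν) ≡ (P <ᵇ Q)
team-<ᵇ {P} {Q} μ ν Q≢P with <-cmp P Q
... | tri< P<Q _ _ = trans (<ᵇ-true (team-< μ ν P<Q)) (sym (<ᵇ-true P<Q))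
... | tri≈ _ P≡Q _ = contradiction (sym P≡Q) Q≢P
... | tri> _ _ Q<P = trans (<ᵇ-false (<⇒≤ (team-< ν μ Q<P))) (sym (<ᵇ-false (<⇒≤ Q<P)))

-- Ranking-fairness

hosts : ℕ → ℕ → Bool
hosts x y = (x <ᵇ y) xor even (x + y)

hosts-flip : ∀ {x y} → x ≢ y → hosts y x ≡ not (hosts x y)
hosts-flip {x} {y} x≢y = begin
  (y <ᵇ x) xor even (y + x)           ≡⟨ cong₂ _xor_ <ᵇ-flip (cong even (+-comm y x)) ⟩
  not (x <ᵇ y) xor even (x + y)       ≡⟨ sym (not-distribˡ-xor (x <ᵇ y) (even (x + y))) ⟩
  not (hosts x y)                     ∎
  where
  open ≡-Reasoning
  <ᵇ-flip : (y <ᵇ x) ≡ not (x <ᵇ y)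
  <ᵇ-flip with <-cmp x y
  ... | tri< x<y _ _ = trans (<ᵇ-false (<⇒≤ x<y)) (cong not (sym (<ᵇ-true x<y)))
  ... | tri≈ _ x≡y _ = contradiction x≡y x≢y
  ... | tri> _ _ y<x = trans (<ᵇ-true y<x) (cong not (sym (<ᵇ-false (<⇒≤ y<x))))

hosts-team : ∀ P μ Q ν → hosts (team P μ) (team Q ν) ≡ (team P μ <ᵇ team Q ν) xor not (μ xor ν)
hosts-team P μ Q ν = cong ((team P μ <ᵇ team Q ν) xor_) (begin
  even (team P μ + team Q ν)                       ≡⟨ even-+ (team P μ) (team Q ν) ⟩
  not (even (team P μ) xor even (team Q ν))
    ≡⟨ cong₂ (λ a b → not (a xor b)) (even-2*+bit P μ) (even-2*+bit Q ν) ⟩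
  not (not μ xor not ν)                            ≡⟨ cong not (xor-annihilates-not μ ν) ⟩
  not (μ xor ν)                                    ∎)
  where open ≡-Reasoning

<ᵇ-suc : ∀ {x a} → a ≢ x → (x <ᵇ suc a) ≡ (x <ᵇ a)
<ᵇ-suc {x} {a} a≢x with <-cmp x a
... | tri< x<a _ _ = trans (<ᵇ-true (m<n⇒m<1+n x<a)) (sym (<ᵇ-true x<a))
... | tri≈ _ x≡a _ = contradiction (sym x≡a) a≢x
... | tri> _ _ a<x = trans (<ᵇ-false a<x) (sym (<ᵇ-false (<⇒≤ a<x)))

hosts-step : ∀ x a → a ≢ x → hosts x (suc a) ≡ not (hosts x a)
hosts-step x a a≢x = begin
  (x <ᵇ suc a) xor even (x + suc a)     ≡⟨ cong₂ _xor_ (<ᵇ-suc a≢x) (cong even (+-suc x a)) ⟩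
  (x <ᵇ a) xor not (even (x + a))       ≡⟨ sym (not-distribʳ-xor (x <ᵇ a) (even (x + a))) ⟩
  not (hosts x a)                       ∎
  where open ≡-Reasoning

hosts-skip : ∀ x → hosts x (suc x) ≡ hosts x x
hosts-skip x = begin
  (x <ᵇ suc x) xor even (x + suc x)     ≡⟨ cong₂ _xor_ (<ᵇ-true (n<1+n x)) (cong even (+-suc x x)) ⟩
  true xor not (even (x + x))           ≡⟨ not-involutive (even (x + x)) ⟩
  even (x + x)                          ≡⟨ cong (_xor even (x + x)) (sym (<ᵇ-false (≤-refl {x}))) ⟩
  hosts x x                             ∎
  where open ≡-Reasoning

EnumeratesFrom : ∀ {l n} → (Fin l → Fin n) → ℕ → Set
EnumeratesFrom f a = ∀ j → toℕ (f j) ≡ a + toℕ j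

EnumeratesFrom-suc : ∀ {l n a} {f : Fin (suc l) → Fin n} → EnumeratesFrom f a → EnumeratesFrom (f ∘ fsuc) (suc a)
EnumeratesFrom-suc {a = a} f≗ j = trans (f≗ (fsuc j)) (+-suc a (toℕ j))

-- hosts x a is the venue of x against the first opponent from a on, also when a = x (hosts-skip).
hosts-alternate-from : ∀ {n} (i : Fin n) {l} (f : Fin l → Fin n) a b → EnumeratesFrom f a → b ≡ not (hosts (toℕ i) a) →
                       Alternating (b ∷ map (hosts (toℕ i) ∘ toℕ) (filterᵇ (λ j → not ⌊ j ≟ᶠ i ⌋) (tabulate f)))
hosts-alternate-from i {zero}  f a b f≗ b≡ = tt
hosts-alternate-from i {suc l} f a b f≗ b≡ with f fzero ≟ᶠ i | trans (f≗ fzero) (+-identityʳ a)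
... | yes f0≡i | f0≡a = hosts-alternate-from i (f ∘ fsuc) (suc a) b (EnumeratesFrom-suc f≗) (trans b≡ (cong not (sym skip)))
  where
  skip : hosts (toℕ i) (suc a) ≡ hosts (toℕ i) a
  skip rewrite sym (trans (sym (cong toℕ f0≡i)) f0≡a) = hosts-skip (toℕ i)
... | no f0≢i | f0≡a = b≢h , hosts-alternate-from i (f ∘ fsuc) (suc a) h (EnumeratesFrom-suc f≗) h≡
  where
  h = hosts (toℕ i) (toℕ (f fzero))
  h≡ : h ≡ not (hosts (toℕ i) (suc a))
  h≡ = begin
    h                                   ≡⟨ cong (hosts (toℕ i)) f0≡a ⟩
    hosts (toℕ i) a                     ≡⟨ sym (not-involutive _) ⟩
    not (not (hosts (toℕ i) a))         ≡⟨ cong not (sym (hosts-step (toℕ i) a a≢i)) ⟩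
    not (hosts (toℕ i) (suc a))         ∎
    where
    open ≡-Reasoning
    a≢i : a ≢ toℕ i
    a≢i a≡i = f0≢i (toℕ-injective (trans f0≡a a≡i))
  b≢h : b ≢ h
  b≢h b≡h = not-¬ (cong (hosts (toℕ i)) f0≡a) (trans (sym b≡h) b≡)

Alternating-tail : ∀ {b bs} → Alternating (b ∷ bs) → Alternating bs
Alternating-tail {bs = []}    _       = tt
Alternating-tail {bs = _ ∷ _} (_ , p) = p

rankingFair : ∀ {n} (s : Schedule n) → (∀ i j → home s i j ≡ hosts (toℕ i) (toℕ j)) → RankingFair s
rankingFair s home≡hosts i =
  subst Alternating (sym (map-cong (home≡hosts i) _))
    (Alternating-tail (hosts-alternate-from i (λ j → j) 0 _ (λ _ → refl) refl))

-- Feasibility and venues of schedules with injective rounds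

toℕ-≢ : ∀ {n} {i j : Fin n} → i ≢ j → toℕ i ≢ toℕ j
toℕ-≢ i≢j = i≢j ∘ toℕ-injective

injective⇒surjective : ∀ {n} (f : Fin n → Fin n) → Injective _≡_ _≡_ f → ∀ y → Σ (Fin n) λ x → f x ≡ y
injective⇒surjective {suc n} f f-inj y with any? (λ x → f x ≟ᶠ y)
... | yes hit = hit
... | no miss with pigeonhole (n<1+n n) (λ x → punchOut {i = y} {j = f x} (λ y≡fx → miss (x , sym y≡fx)))
...   | a , b , a<b , eq = contradiction (f-inj (punchOut-injective (λ e → miss (a , sym e)) (λ e → miss (b , sym e)) eq)) (<⇒≢ᶠ a<b)

any-unique : ∀ {A : Set} (p : A → Bool) xs a → a ∈ xs → (∀ b → T (p b) → b ≡ a) → any p xs ≡ p a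
any-unique p xs a a∈xs unique with p a in pa
... | true  = T⇒≡true (any⁺ p (Any.map (λ { refl → subst T (sym pa) tt }) a∈xs))
... | false = ¬T⇒≡false λ t → let (b , pb) = Any.satisfied (any⁻ p xs t) in subst T pa (subst (T ∘ p) (unique b pb) pb)

OpponentInjective : ∀ {n} → Schedule (suc n) → Set
OpponentInjective {n} s = ∀ i j j′ → j ≢ i → j′ ≢ i → round s i j ≡ round s i j′ → j ≡ j′

feasible : ∀ {n} (s : Schedule (suc n)) → OpponentInjective s → Feasible s
feasible s inj i r with injective⇒surjective (λ t → round s i (punchIn i t)) opp-inj r
  where
  opp-inj : Injective _≡_ _≡_ (λ t → round s i (punchIn i t))
  opp-inj {t} {t′} eq = punchIn-injective i t t′ (inj i _ _ (punchInᵢ≢i i t) (punchInᵢ≢i i t′) eq)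
... | t , round≡r =
  (punchIn i t , punchInᵢ≢i i t , round≡r) ,
  λ j j′ j≢i j′≢i eq eq′ → inj i j j′ j≢i j′≢i (trans eq (sym eq′))

venue-opponent : ∀ {n} (s : Schedule (suc n)) → OpponentInjective s →
                 ∀ i j → j ≢ i → venue s i (toℕ (round s i j)) ≡ home s i j
venue-opponent s inj i j j≢i = begin
  venue s i (toℕ (round s i j))  ≡⟨ any-unique meets (allFin _) j (∈-allFin j) unique ⟩
  meets j
    ≡⟨ cong₂ (λ a b → not a ∧ b ∧ home s i j) (⌊⌋-false (j ≟ᶠ i) j≢i) (≡ᵇ-true (refl {x = toℕ (round s i j)})) ⟩
  home s i j                     ∎
  where
  open ≡-Reasoning
  meets : _ → Bool
  meets j′ = not ⌊ j′ ≟ᶠ i ⌋ ∧ (toℕ (round s i j′) ≡ᵇ toℕ (round s i j)) ∧ home s i j′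
  unique : ∀ j′ → T (meets j′) → j′ ≡ j
  unique j′ t with Equivalence.to (T-∧ {not ⌊ j′ ≟ᶠ i ⌋}) t
  ... | j′≢i , t′ = inj i j′ j (toWitnessFalse {a? = j′ ≟ᶠ i} j′≢i) j≢i
                      (toℕ-injective (≡ᵇ⇒≡ _ _ (proj₁ (Equivalence.to (T-∧ {toℕ (round s i j′) ≡ᵇ _}) t′))))

venue-from-rounds : ∀ {n} (s : Schedule (suc n)) (h : Fin (suc n) → ℕ → Bool) → OpponentInjective s →
                    (∀ i j → j ≢ i → home s i j ≡ h i (toℕ (round s i j))) → ∀ i t → t < n → venue s i t ≡ h i t
venue-from-rounds s h inj home≡h i t t<n with feasible s inj i (fromℕ< t<n)
... | (j , j≢i , round≡t) , _ = begin
  venue s i t                       ≡⟨ cong (venue s i) (sym toℕ-round) ⟩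
  venue s i (toℕ (round s i j))     ≡⟨ venue-opponent s inj i j j≢i ⟩
  home s i j                        ≡⟨ home≡h i j j≢i ⟩
  h i (toℕ (round s i j))           ≡⟨ cong (h i) toℕ-round ⟩
  h i t                             ∎
  where
  open ≡-Reasoning
  toℕ-round : toℕ (round s i j) ≡ t
  toℕ-round = trans (cong toℕ round≡t) (toℕ-fromℕ< t<n)

-- Cyclic home-away patterns with a single break

BreaksExactlyAt : ℕ → (ℕ → Bool) → ℕ → Set
BreaksExactlyAt m h β = ∀ u → u < m → h (cycPred m u) ≡ h u ⇔ u ≡ β

cycPred< : ∀ {m t} → t < m → cycPred m t < m
cycPred< {suc m} {zero}  _   = n<1+n m
cycPred< {m}     {suc t} t<m = <-trans (n<1+n t) t<m

BreaksExactlyAt-cong : ∀ {m h h′ β} → (∀ t → t < m → h′ t ≡ h t) → BreaksExactlyAt m h β → BreaksExactlyAt m h′ β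
BreaksExactlyAt-cong h′≗h breaks t t<m =
  mk⇔ (λ eq → Equivalence.to (breaks t t<m) (trans (sym (h′≗h _ (cycPred< t<m))) (trans eq (h′≗h t t<m))))
      (λ t≡β → trans (h′≗h _ (cycPred< t<m)) (trans (Equivalence.from (breaks t t<m) t≡β) (sym (h′≗h t t<m))))

singleBreak : ∀ {n} (s : Schedule (suc n)) →
              (∀ i → Σ ℕ λ β → β < n × BreaksExactlyAt n (venue s i) β) → SingleBreak s
singleBreak s breaks i with breaks i
... | β , β<n , breaks-at-β =
  fromℕ< β<n ,
  Equivalence.from (breaks-at-β (toℕ (fromℕ< β<n)) (toℕ<n (fromℕ< β<n))) (toℕ-fromℕ< β<n) ,
  λ r break → toℕ-injective (trans (Equivalence.to (breaks-at-β (toℕ r) (toℕ<n r)) break) (sym (toℕ-fromℕ< β<n)))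

hapBreakingAt : ℕ → ℕ → Bool
hapBreakingAt b w = even w xor (b ≤ᵇ w)

hapBreakingAt-below : ∀ {b w} → w < b → hapBreakingAt b w ≡ even w
hapBreakingAt-below {w = w} w<b = trans (cong (even w xor_) (≤ᵇ-false w<b)) (xor-identityʳ (even w))

hapBreakingAt-above : ∀ {b w} → b ≤ w → hapBreakingAt b w ≡ not (even w)
hapBreakingAt-above {w = w} b≤w = trans (cong (even w xor_) (≤ᵇ-true b≤w)) (xor-comm (even w) true)

hapBreakingAt-team : ∀ b P c → hapBreakingAt b (team P c) ≡ not c xor (b ≤ᵇ team P c)
hapBreakingAt-team b P c = cong (_xor (b ≤ᵇ team P c)) (even-2*+bit P c)

hapBreakingAt-step : ∀ b u → hapBreakingAt b u ≡ hapBreakingAt b (suc u) ⇔ suc u ≡ b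
hapBreakingAt-step b u with <-cmp b (suc u)
... | tri< b<1+u _ _ =
  mk⇔ (λ eq → contradiction (trans (sym (hapBreakingAt-above (≤-pred b<1+u))) (trans eq (hapBreakingAt-above (<⇒≤ b<1+u))))
                            (not-¬ refl))
      (λ 1+u≡b → contradiction (sym 1+u≡b) (<⇒≢ b<1+u))
... | tri≈ _ b≡1+u _ =
  mk⇔ (λ _ → sym b≡1+u)
      (λ _ → trans (hapBreakingAt-below (≤-reflexive (sym b≡1+u)))
                   (trans (sym (not-involutive _)) (sym (hapBreakingAt-above (≤-reflexive b≡1+u)))))
... | tri> _ _ 1+u<b =
  mk⇔ (λ eq → contradiction (trans (sym (hapBreakingAt-below (<-trans (n<1+n u) 1+u<b))) (trans eq (hapBreakingAt-below 1+u<b)))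
                            (not-¬ refl))
      (λ 1+u≡b → contradiction 1+u≡b (<⇒≢ 1+u<b))

pred<self : ∀ m .{{_ : NonZero m}} → pred m < m
pred<self m = subst (pred m <_) (suc-pred m) (n<1+n (pred m))

hapBreakingAt-breaks-inside : ∀ {m b} .{{_ : NonZero m}} → even (pred m) ≡ true → b < m →
                              BreaksExactlyAt m (hapBreakingAt b) b
hapBreakingAt-breaks-inside {m} {zero} even-pred _ zero _ =
  mk⇔ (λ _ → refl)
      (λ _ → trans (hapBreakingAt-above {w = pred m} z≤n) (trans (cong not even-pred) (sym (hapBreakingAt-above {w = 0} z≤n))))
hapBreakingAt-breaks-inside {m} {suc b} even-pred b<m zero _ =
  mk⇔ (λ eq → contradiction (trans (sym (trans (hapBreakingAt-above {w = pred m} (<⇒≤pred b<m)) (cong not even-pred)))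
                                   (trans eq (hapBreakingAt-below {w = 0} (z<s {n = b}))))
                            λ ())
      (λ ())
hapBreakingAt-breaks-inside {b = b} _ _ (suc u) _ = hapBreakingAt-step b u

hapBreakingAt-breaks-wrap : ∀ {m} .{{_ : NonZero m}} → even (pred m) ≡ true → BreaksExactlyAt m (hapBreakingAt m) 0
hapBreakingAt-breaks-wrap {m} even-pred zero _ =
  mk⇔ (λ _ → refl)
      (λ _ → trans (hapBreakingAt-below (pred<self m)) (trans even-pred (sym (hapBreakingAt-below (>-nonZero⁻¹ m)))))
hapBreakingAt-breaks-wrap {m} _ (suc u) u<m =
  mk⇔ (λ eq → contradiction (Equivalence.to (hapBreakingAt-step m u) eq) (<⇒≢ u<m)) (λ ())

hapBreakingAt-breaks : ∀ {m b} .{{_ : NonZero m}} → even (pred m) ≡ true → b ≤ m →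
                       BreaksExactlyAt m (hapBreakingAt b) (b % m)
hapBreakingAt-breaks {m} {b} even-pred b≤m with m≤n⇒m<n∨m≡n b≤m
... | inj₁ b<m  = subst (BreaksExactlyAt m (hapBreakingAt b)) (sym (m<n⇒m%n≡m b<m)) (hapBreakingAt-breaks-inside even-pred b<m)
... | inj₂ refl = subst (BreaksExactlyAt m (hapBreakingAt m)) (sym (n%n≡0 m)) (hapBreakingAt-breaks-wrap even-pred)

module Rotation (m : ℕ) .{{_ : NonZero m}} where

  %-absorbˡ : ∀ x y → (x % m + y) % m ≡ (x + y) % m
  %-absorbˡ x y = begin
    (x % m + y) % m              ≡⟨ %-distribˡ-+ (x % m) y m ⟩
    (x % m % m + y % m) % m      ≡⟨ cong (λ z → (z + y % m) % m) (m%n%n≡m%n x m) ⟩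
    (x % m + y % m) % m          ≡⟨ sym (%-distribˡ-+ x y m) ⟩
    (x + y) % m                  ∎
    where open ≡-Reasoning

  %-absorbʳ : ∀ x y → (x + y % m) % m ≡ (x + y) % m
  %-absorbʳ x y = begin
    (x + y % m) % m   ≡⟨ cong (_% m) (+-comm x (y % m)) ⟩
    (y % m + x) % m   ≡⟨ %-absorbˡ y x ⟩
    (y + x) % m       ≡⟨ cong (_% m) (+-comm y x) ⟩
    (x + y) % m       ∎
    where open ≡-Reasoning

  relative : ℕ → ℕ → ℕ
  relative a t = (t + (m ∸ a)) % m

  +-relative : ∀ {a} t → a ≤ m → t < m → (a + relative a t) % m ≡ t
  +-relative {a} t a≤m t<m = begin
    (a + (t + (m ∸ a)) % m) % m   ≡⟨ %-absorbʳ a (t + (m ∸ a)) ⟩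
    (a + (t + (m ∸ a))) % m       ≡⟨ cong (_% m) a+[t+[m∸a]]≡t+m ⟩
    (t + m) % m                   ≡⟨ [m+n]%n≡m%n t m ⟩
    t % m                         ≡⟨ m<n⇒m%n≡m t<m ⟩
    t                             ∎
    where
    open ≡-Reasoning
    a+[t+[m∸a]]≡t+m : a + (t + (m ∸ a)) ≡ t + m
    a+[t+[m∸a]]≡t+m = trans (+-comm a _) (trans (+-assoc t (m ∸ a) a) (cong (t +_) (m∸n+n≡m a≤m)))

  relative-+ : ∀ {a} s → a ≤ m → s < m → relative a ((a + s) % m) ≡ s
  relative-+ {a} s a≤m s<m = begin
    ((a + s) % m + (m ∸ a)) % m   ≡⟨ %-absorbˡ (a + s) (m ∸ a) ⟩
    (a + s + (m ∸ a)) % m         ≡⟨ cong (_% m) a+s+[m∸a]≡s+m ⟩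
    (s + m) % m                   ≡⟨ [m+n]%n≡m%n s m ⟩
    s % m                         ≡⟨ m<n⇒m%n≡m s<m ⟩
    s                             ∎
    where
    open ≡-Reasoning
    a+s+[m∸a]≡s+m : a + s + (m ∸ a) ≡ s + m
    a+s+[m∸a]≡s+m = trans (cong (_+ (m ∸ a)) (+-comm a s)) (trans (+-assoc s a (m ∸ a)) (cong (s +_) (m+[n∸m]≡n a≤m)))

  cycPred-suc : ∀ {u} → u < m → cycPred m (suc u % m) ≡ u
  cycPred-suc {u} u<m with m≤n⇒m<n∨m≡n u<m
  ... | inj₁ 1+u<m rewrite m<n⇒m%n≡m 1+u<m = refl
  ... | inj₂ 1+u≡m = trans (cong (λ z → cycPred m (z % m)) 1+u≡m) (trans (cong (cycPred m) (n%n≡0 m)) (sym (cong pred 1+u≡m)))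

  suc-cycPred : ∀ t c → (suc (cycPred m t) + c) % m ≡ (t + c) % m
  suc-cycPred zero    c = trans (cong (λ z → (z + c) % m) (suc-pred m)) (trans (cong (_% m) (+-comm m c)) ([m+n]%n≡m%n c m))
  suc-cycPred (suc t) c = refl

  relative-cycPred : ∀ a t → relative a (cycPred m t) ≡ cycPred m (relative a t)
  relative-cycPred a t = sym (begin
    cycPred m ((t + (m ∸ a)) % m)                        ≡⟨ cong (cycPred m) (sym (suc-cycPred t (m ∸ a))) ⟩
    cycPred m ((suc (cycPred m t) + (m ∸ a)) % m)        ≡⟨ cong (cycPred m) (sym (%-absorbʳ 1 (cycPred m t + (m ∸ a)))) ⟩
    cycPred m (suc (relative a (cycPred m t)) % m)       ≡⟨ cycPred-suc (m%n<n _ m) ⟩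
    relative a (cycPred m t)                             ∎)
    where open ≡-Reasoning

  relative≡⇔ : ∀ {a t β} → a ≤ m → t < m → β < m → relative a t ≡ β ⇔ t ≡ (a + β) % m
  relative≡⇔ {a} {t} a≤m t<m β<m =
    mk⇔ (λ rel≡β → trans (sym (+-relative t a≤m t<m)) (cong (λ z → (a + z) % m) rel≡β))
        (λ t≡ → trans (cong (relative a) t≡) (relative-+ _ a≤m β<m))

  rotate-breaks : ∀ {h a β} → a ≤ m → β < m → BreaksExactlyAt m h β →
                  BreaksExactlyAt m (h ∘ relative a) ((a + β) % m)
  rotate-breaks {h} {a} a≤m β<m breaks t t<m =
    mk⇔ (λ eq → Equivalence.to rel⇔ (Equivalence.to at-rel (subst (λ z → h z ≡ h (relative a t)) (relative-cycPred a t) eq)))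
        (λ t≡ → subst (λ z → h z ≡ h (relative a t)) (sym (relative-cycPred a t))
                      (Equivalence.from at-rel (Equivalence.from rel⇔ t≡)))
    where
    at-rel = breaks (relative a t) (m%n<n _ m)
    rel⇔ = relative≡⇔ a≤m t<m β<m

-- The schedule

module Construction (K : ℕ) where

  m : ℕ
  m = 4 * K + 3

  instance
    m-nonZero : NonZero m
    m-nonZero = >-nonZero (subst (0 <_) (+-comm 3 (4 * K)) z<s)

  open Rotation m

  apex : ℕ
  apex = 2 * K + 1

  early : ℕ → Bool
  early P = P ≤ᵇ K

  early-true : ∀ {P} → P ≤ K → early P ≡ true
  early-true = ≤ᵇ-true

  early-false : ∀ {P} → K < P → early P ≡ false
  early-false = ≤ᵇ-false

  K<apex : K < apex
  K<apex = ≤-trans (s≤s (m≤m+n K K)) (≤-reflexive (arith K))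
    where
    arith : ∀ K → suc (K + K) ≡ 2 * K + 1
    arith = solve-∀

  ≤apex⇒≤2K : ∀ {P} → P ≤ apex → P ≢ apex → P ≤ 2 * K
  ≤apex⇒≤2K {P} P≤a P≢a = ≤-pred (subst (P <_) (+-comm (2 * K) 1) (≤∧≢⇒< P≤a P≢a))

  team-apex : team apex false ≡ 4 * K + 2
  team-apex = arith K
    where
    arith : ∀ K → 2 * (2 * K + 1) + 0 ≡ 4 * K + 2
    arith = solve-∀

  -- the apex meets the other-parity member of Q in round 4Q + [K < Q]; here counted from round 2 · apex = m − 1
  apexSlot : ℕ → ℕ
  apexSlot Q = if early Q then 4 * Q + 1 else 4 * (Q ∸ suc K) + 3

  -- the round in which (P, μ) meets (Q, ν), counted from round 2P (see roundℕ)
  slot : ℕ → Bool → ℕ → Bool → ℕ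
  slot P μ Q ν =
    if P ≡ᵇ Q then 2 * P + bit (early P)
    else if (μ xor ν) ∧ (P ≡ᵇ apex) then apexSlot Q
    else if (μ xor ν) ∧ (Q ≡ᵇ apex) then 2 * P + bit (not (early P))
    else 2 * Q + bit (μ xor ν)

  -- the single break of (P, μ), counted from round 2P; the value m stands for round 0
  breakOf : ℕ → Bool → ℕ
  breakOf P μ = if early P then 2 * P + 1 + bit μ else 2 * P + bit (not μ)

  data Opponent : ℕ → Bool → ℕ → Bool → Set where
    partner  : ∀ {P μ} → Opponent P μ P (not μ)
    toApex   : ∀ {P μ} → P ≢ apex → Opponent P μ apex (not μ)
    fromApex : ∀ {Q μ} → Q ≢ apex → Opponent apex μ Q (not μ)
    plain    : ∀ {P μ Q ν} → Q ≢ P → μ ≡ ν ⊎ P ≢ apex × Q ≢ apex → Opponent P μ Q ν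

  classify : ∀ P μ Q ν → (P , μ) ≢ (Q , ν) → Opponent P μ Q ν
  classify P μ Q ν different with P ≟ Q | μ ≟ᵇ ν
  ... | yes refl | yes refl = contradiction refl different
  ... | yes refl | no μ≢ν   = subst (Opponent P μ P) (sym (¬-not (μ≢ν ∘ sym))) partner
  ... | no P≢Q   | yes μ≡ν  = plain (P≢Q ∘ sym) (inj₁ μ≡ν)
  ... | no P≢Q   | no μ≢ν with P ≟ apex | Q ≟ apex
  ...   | yes refl | _        = subst (Opponent apex μ Q) (sym (¬-not (μ≢ν ∘ sym))) (fromApex (P≢Q ∘ sym))
  ...   | no P≢a   | yes refl = subst (Opponent P μ apex) (sym (¬-not (μ≢ν ∘ sym))) (toApex P≢a)
  ...   | no P≢a   | no Q≢a   = plain (P≢Q ∘ sym) (inj₂ (P≢a , Q≢a))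

  slot-partner : ∀ P μ ν → slot P μ P ν ≡ 2 * P + bit (early P)
  slot-partner P μ ν rewrite ≡ᵇ-true (refl {x = P}) = refl

  slot-toApex : ∀ {P μ ν} → P ≢ apex → μ ≢ ν → slot P μ apex ν ≡ 2 * P + bit (not (early P))
  slot-toApex {P} P≢a μ≢ν rewrite ≡ᵇ-false P≢a | xor-≢ μ≢ν | ≡ᵇ-true (refl {x = apex}) = refl

  slot-fromApex : ∀ {μ Q ν} → Q ≢ apex → μ ≢ ν → slot apex μ Q ν ≡ apexSlot Q
  slot-fromApex Q≢a μ≢ν rewrite ≡ᵇ-false (Q≢a ∘ sym) | xor-≢ μ≢ν | ≡ᵇ-true (refl {x = apex}) = refl

  slot-plain : ∀ {P μ Q ν} → Q ≢ P → μ ≡ ν ⊎ P ≢ apex × Q ≢ apex → slot P μ Q ν ≡ 2 * Q + bit (μ xor ν)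
  slot-plain {P} {μ} {Q} Q≢P (inj₁ refl) rewrite ≡ᵇ-false (Q≢P ∘ sym) | xor-same μ = refl
  slot-plain {P} {μ} {Q} {ν} Q≢P (inj₂ (P≢a , Q≢a))
    rewrite ≡ᵇ-false (Q≢P ∘ sym) | ≡ᵇ-false P≢a | ≡ᵇ-false Q≢a | ∧-zeroʳ (μ xor ν) = refl

  apex-game-sym : ∀ {P} → P < apex → (2 * P + (2 * P + bit (not (early P)))) % m ≡ (2 * apex + apexSlot P) % m
  apex-game-sym {P} P<apex with P ≤? K
  ... | yes P≤K rewrite early-true P≤K = sym (begin
    (2 * (2 * K + 1) + (4 * P + 1)) % m        ≡⟨ cong (_% m) (solve (K ∷ P ∷ [])) ⟩
    (2 * P + (2 * P + 0) + (4 * K + 3)) % m    ≡⟨ [m+n]%n≡m%n (2 * P + (2 * P + 0)) m ⟩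
    (2 * P + (2 * P + 0)) % m                  ∎)
    where open ≡-Reasoning
  ... | no P≰K with m≤n⇒∃[o]m+o≡n (≰⇒> P≰K)
  ...   | d , refl rewrite early-false (≰⇒> P≰K) | m+n∸m≡n (suc K) d = cong (_% m) (arith K d)
    where
    arith : ∀ K d → 2 * (suc K + d) + (2 * (suc K + d) + 1) ≡ 2 * (2 * K + 1) + (4 * d + 3)
    arith = solve-∀

  plain-sym : ∀ {P Q} {μ ν : Bool} → μ ≡ ν ⊎ P ≢ apex × Q ≢ apex → ν ≡ μ ⊎ Q ≢ apex × P ≢ apex
  plain-sym (inj₁ μ≡ν)         = inj₁ (sym μ≡ν)
  plain-sym (inj₂ (P≢a , Q≢a)) = inj₂ (Q≢a , P≢a)

  slot-sym : ∀ {P μ Q ν} → P ≤ apex → Q ≤ apex → Opponent P μ Q ν →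
             (2 * P + slot P μ Q ν) % m ≡ (2 * Q + slot Q ν P μ) % m
  slot-sym {P} {μ} _ _ partner rewrite slot-partner P μ (not μ) | slot-partner P (not μ) μ = refl
  slot-sym {P} {μ} P≤a _ (toApex P≢a)
    rewrite slot-toApex {P} {μ} P≢a (not-¬ refl) | slot-fromApex {not μ} P≢a (not-¬ refl ∘ sym) =
    apex-game-sym (≤∧≢⇒< P≤a P≢a)
  slot-sym {μ = μ} {Q} _ Q≤a (fromApex Q≢a)
    rewrite slot-fromApex {μ} Q≢a (not-¬ refl) | slot-toApex {Q} {not μ} Q≢a (not-¬ refl ∘ sym) =
    sym (apex-game-sym (≤∧≢⇒< Q≤a Q≢a))
  slot-sym {P} {μ} {Q} {ν} _ _ (plain Q≢P cond)
    rewrite slot-plain Q≢P cond | slot-plain (Q≢P ∘ sym) (plain-sym cond) | xor-comm ν μ =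
    cong (_% m) (x∙yz≈y∙xz (2 * P) (2 * Q) (bit (μ xor ν)))

  team<4K+2 : ∀ {P} b → P ≤ 2 * K → team P b < 4 * K + 2
  team<4K+2 {P} b P≤2K = begin-strict
    2 * P + bit b          ≤⟨ +-mono-≤ (*-monoʳ-≤ 2 P≤2K) (bit≤1 b) ⟩
    2 * (2 * K) + 1        <⟨ n<1+n _ ⟩
    suc (2 * (2 * K) + 1)  ≡⟨ solve (K ∷ []) ⟩
    4 * K + 2              ∎
    where open ≤-Reasoning

  apexSlot<4K+2 : ∀ {Q} → Q < apex → apexSlot Q < 4 * K + 2
  apexSlot<4K+2 {Q} Q<apex with Q ≤? K
  ... | yes Q≤K rewrite early-true Q≤K = begin-strict
    4 * Q + 1     ≤⟨ +-monoˡ-≤ 1 (*-monoʳ-≤ 4 Q≤K) ⟩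
    4 * K + 1     <⟨ +-monoʳ-< (4 * K) (n<1+n 1) ⟩
    4 * K + 2     ∎
    where open ≤-Reasoning
  ... | no Q≰K with m≤n⇒∃[o]m+o≡n (≰⇒> Q≰K)
  ...   | d , refl rewrite early-false (≰⇒> Q≰K) | m+n∸m≡n (suc K) d = begin-strict
    4 * d + 3           <⟨ n<1+n _ ⟩
    suc (4 * d + 3)     ≡⟨ solve (d ∷ []) ⟩
    4 * suc d           ≤⟨ *-monoʳ-≤ 4 d<K ⟩
    4 * K               ≤⟨ m≤m+n (4 * K) 2 ⟩
    4 * K + 2           ∎
    where
    open ≤-Reasoning
    arith : ∀ K → 2 * K + 1 ≡ suc (K + K)
    arith = solve-∀
    d<K : d < K
    d<K = +-cancelˡ-< K d K (≤-pred (subst (suc K + d <_) (arith K) Q<apex))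

  <4K+2⇒<m : ∀ {x} → x < 4 * K + 2 → x < m
  <4K+2⇒<m x<4K+2 = <-trans x<4K+2 (+-monoʳ-< (4 * K) (n<1+n 2))

  team-apex<m : team apex false < m
  team-apex<m = subst (_< m) (sym team-apex) (+-monoʳ-< (4 * K) (n<1+n 2))

  slot<m : ∀ {P μ Q ν} → P ≤ apex → Q ≤ apex → Opponent P μ Q ν → slot P μ Q ν < m
  slot<m {P} {μ} P≤a _ partner rewrite slot-partner P μ (not μ) with P ≟ apex
  ... | yes refl rewrite early-false K<apex = team-apex<m
  ... | no P≢a = <4K+2⇒<m (team<4K+2 (early P) (≤apex⇒≤2K P≤a P≢a))
  slot<m {P} {μ} P≤a _ (toApex P≢a) rewrite slot-toApex {P} {μ} P≢a (not-¬ refl) =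
    <4K+2⇒<m (team<4K+2 (not (early P)) (≤apex⇒≤2K P≤a P≢a))
  slot<m {μ = μ} _ Q≤a (fromApex Q≢a) rewrite slot-fromApex {μ} Q≢a (not-¬ refl) =
    <4K+2⇒<m (apexSlot<4K+2 (≤∧≢⇒< Q≤a Q≢a))
  slot<m {P} {μ} {Q} {ν} _ Q≤a (plain Q≢P cond) rewrite slot-plain Q≢P cond with Q ≟ apex | cond
  ... | yes refl | inj₁ refl rewrite xor-same μ = team-apex<m
  ... | yes refl | inj₂ (_ , Q≢a) = contradiction refl Q≢a
  ... | no Q≢a   | _ = <4K+2⇒<m (team<4K+2 (μ xor ν) (≤apex⇒≤2K Q≤a Q≢a))

  opponentOfApex : Bool → ℕ → ℕ × Bool
  opponentOfApex μ w =
    if even w then (⌊ w /2⌋ , μ)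
    else if even ⌊ w /2⌋ then (⌊ ⌊ w /2⌋ /2⌋ , not μ)
    else (suc K + ⌊ ⌊ w /2⌋ /2⌋ , not μ)

  opponentAt : ℕ → Bool → ℕ → ℕ × Bool
  opponentAt P μ w =
    if w ≡ᵇ 4 * K + 2 then (apex , μ xor (P ≡ᵇ apex))
    else if P ≡ᵇ apex then opponentOfApex μ w
    else if ⌊ w /2⌋ ≡ᵇ P then (if w ≡ᵇ 2 * P + bit (early P) then (P , not μ) else (apex , not μ))
    else (⌊ w /2⌋ , μ xor odd w)

  apexSlot-team : ∀ Q → apexSlot Q ≡ (if early Q then team (team Q false) true else team (team (Q ∸ suc K) true) true)
  apexSlot-team Q with early Q
  ... | true  = arith Q
    where
    arith : ∀ Q → 4 * Q + 1 ≡ 2 * (2 * Q + 0) + 1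
    arith = solve-∀
  ... | false = arith (Q ∸ suc K)
    where
    arith : ∀ d → 4 * d + 3 ≡ 2 * (2 * d + 1) + 1
    arith = solve-∀

  opponentOfApex-team : ∀ μ R c → opponentOfApex μ (team (team R c) true) ≡ ((if c then suc K + R else R) , not μ)
  opponentOfApex-team μ R c
    rewrite even-2*+bit (team R c) true | ⌊team/2⌋ (team R c) true | even-2*+bit R c | ⌊team/2⌋ R c with c
  ... | false = refl
  ... | true  = refl

  opponentAt-last : ∀ P μ → opponentAt P μ (4 * K + 2) ≡ (apex , μ xor (P ≡ᵇ apex))
  opponentAt-last P μ rewrite ≡ᵇ-true (refl {x = 4 * K + 2}) = refl

  opponentAt-apex : ∀ {w} μ → w ≢ 4 * K + 2 → opponentAt apex μ w ≡ opponentOfApex μ w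
  opponentAt-apex μ w≢ rewrite ≡ᵇ-false w≢ | ≡ᵇ-true (refl {x = apex}) = refl

  opponentAt-own : ∀ {P w} μ → w ≢ 4 * K + 2 → P ≢ apex → ⌊ w /2⌋ ≡ P →
                   opponentAt P μ w ≡ (if w ≡ᵇ 2 * P + bit (early P) then (P , not μ) else (apex , not μ))
  opponentAt-own μ w≢ P≢a ⌊w/2⌋≡P rewrite ≡ᵇ-false w≢ | ≡ᵇ-false P≢a | ≡ᵇ-true ⌊w/2⌋≡P = refl

  opponentAt-other : ∀ {P w} μ → w ≢ 4 * K + 2 → P ≢ apex → ⌊ w /2⌋ ≢ P →
                     opponentAt P μ w ≡ (⌊ w /2⌋ , μ xor odd w)
  opponentAt-other μ w≢ P≢a ⌊w/2⌋≢P rewrite ≡ᵇ-false w≢ | ≡ᵇ-false P≢a | ≡ᵇ-false ⌊w/2⌋≢P = refl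

  opponentAt-slot : ∀ {P μ Q ν} → P ≤ apex → Q ≤ apex → Opponent P μ Q ν → opponentAt P μ (slot P μ Q ν) ≡ (Q , ν)
  opponentAt-slot {P} {μ} P≤a _ partner rewrite slot-partner P μ (not μ) with P ≟ apex
  ... | yes refl = begin
    opponentAt apex μ (team apex (early apex))  ≡⟨ cong (λ e → opponentAt apex μ (team apex e)) (early-false K<apex) ⟩
    opponentAt apex μ (team apex false)         ≡⟨ cong (opponentAt apex μ) team-apex ⟩
    opponentAt apex μ (4 * K + 2)               ≡⟨ opponentAt-last apex μ ⟩
    (apex , μ xor (apex ≡ᵇ apex))               ≡⟨ cong (λ b → apex , μ xor b) (≡ᵇ-true (refl {x = apex})) ⟩
    (apex , μ xor true)                         ≡⟨ cong (apex ,_) (xor-comm μ true) ⟩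
    (apex , not μ)                              ∎
    where open ≡-Reasoning
  ... | no P≢a
    rewrite opponentAt-own {P} μ (<⇒≢ (team<4K+2 (early P) (≤apex⇒≤2K P≤a P≢a))) P≢a (⌊team/2⌋ P (early P))
          | ≡ᵇ-true (refl {x = team P (early P)}) = refl
  opponentAt-slot {P} {μ} P≤a _ (toApex P≢a)
    rewrite slot-toApex {P} {μ} P≢a (not-¬ refl)
          | opponentAt-own {P} μ (<⇒≢ (team<4K+2 (not (early P)) (≤apex⇒≤2K P≤a P≢a))) P≢a (⌊team/2⌋ P (not (early P)))
          | ≡ᵇ-false (not-¬ {early P} refl ∘ sym ∘ team-injectiveʳ P) = refl
  opponentAt-slot {μ = μ} {Q} _ Q≤a (fromApex Q≢a)
    rewrite slot-fromApex {μ} Q≢a (not-¬ refl)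
          | opponentAt-apex μ (<⇒≢ (apexSlot<4K+2 (≤∧≢⇒< Q≤a Q≢a)))
          | apexSlot-team Q with Q ≤? K
  ... | yes Q≤K rewrite early-true Q≤K | opponentOfApex-team μ Q false = refl
  ... | no Q≰K rewrite early-false (≰⇒> Q≰K) | opponentOfApex-team μ (Q ∸ suc K) true | m+[n∸m]≡n (≰⇒> Q≰K) = refl
  opponentAt-slot {P} {μ} {Q} {ν} P≤a Q≤a (plain Q≢P cond) rewrite slot-plain Q≢P cond with Q ≟ apex | P ≟ apex | cond
  ... | yes refl | _ | inj₂ (_ , Q≢a) = contradiction refl Q≢a
  ... | yes refl | _ | inj₁ refl = begin
    opponentAt P μ (team apex (μ xor μ))    ≡⟨ cong (λ b → opponentAt P μ (team apex b)) (xor-same μ) ⟩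
    opponentAt P μ (team apex false)        ≡⟨ cong (opponentAt P μ) team-apex ⟩
    opponentAt P μ (4 * K + 2)              ≡⟨ opponentAt-last P μ ⟩
    (apex , μ xor (P ≡ᵇ apex))              ≡⟨ cong (λ b → apex , μ xor b) (≡ᵇ-false (Q≢P ∘ sym)) ⟩
    (apex , μ xor false)                    ≡⟨ cong (apex ,_) (xor-identityʳ μ) ⟩
    (apex , μ)                              ∎
    where open ≡-Reasoning
  ... | no Q≢a | yes refl | inj₂ (P≢a , _) = contradiction refl P≢a
  ... | no Q≢a | yes refl | inj₁ refl
    rewrite xor-same μ | opponentAt-apex μ (<⇒≢ (team<4K+2 false (≤apex⇒≤2K Q≤a Q≢a)))
          | even-2*+bit Q false | ⌊team/2⌋ Q false = refl
  ... | no Q≢a | no P≢a | _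
    rewrite opponentAt-other {P} μ (<⇒≢ (team<4K+2 (μ xor ν) (≤apex⇒≤2K Q≤a Q≢a))) P≢a
                             (λ eq → Q≢P (trans (sym (⌊team/2⌋ Q (μ xor ν))) eq))
          | ⌊team/2⌋ Q (μ xor ν) | odd-team Q (μ xor ν) | sym (xor-assoc μ μ ν) | xor-same μ = refl

  breakOf-bounds : ∀ P μ → 2 * P ≤ breakOf P μ × breakOf P μ ≤ 2 * P + 2
  breakOf-bounds P μ with early P
  ... | true  = ≤-trans (m≤m+n (2 * P) 1) (m≤m+n _ (bit μ)) ,
                ≤-trans (+-monoʳ-≤ (2 * P + 1) (bit≤1 μ)) (≤-reflexive (+-assoc (2 * P) 1 1))
  ... | false = m≤m+n (2 * P) (bit (not μ)) , +-monoʳ-≤ (2 * P) (≤-trans (bit≤1 (not μ)) (n≤1+n 1))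

  breakOf-≤ᵇ : ∀ {P Q} μ δ → Q ≢ P → (breakOf P μ ≤ᵇ team Q δ) ≡ (P <ᵇ Q)
  breakOf-≤ᵇ {P} {Q} μ δ Q≢P with <-cmp P Q | breakOf-bounds P μ
  ... | tri< P<Q _ _ | _ , ≤2P+2 = trans (≤ᵇ-true (≤-trans ≤2P+2 2P+2≤team)) (sym (<ᵇ-true P<Q))
    where
    2P+2≤team : 2 * P + 2 ≤ team Q δ
    2P+2≤team = ≤-trans (≤-reflexive (2*+2≡2*suc P)) (≤-trans (*-monoʳ-≤ 2 P<Q) (m≤m+n (2 * Q) (bit δ)))
  ... | tri≈ _ P≡Q _ | _ = contradiction (sym P≡Q) Q≢P
  ... | tri> _ _ Q<P | 2P≤ , _ = trans (≤ᵇ-false (<-≤-trans team<2P 2P≤)) (sym (<ᵇ-false (<⇒≤ Q<P)))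
    where
    team<2P : team Q δ < 2 * P
    team<2P = subst (team Q δ <_) (+-identityʳ (2 * P)) (team-< δ false Q<P)

  hosts-slot : ∀ {P μ Q ν} → P ≤ apex → Q ≤ apex → Opponent P μ Q ν →
               hosts (team P μ) (team Q ν) ≡ hapBreakingAt (breakOf P μ) (slot P μ Q ν)
  hosts-slot {P} {μ} _ _ partner
    rewrite slot-partner P μ (not μ) | hosts-team P μ P (not μ) | xor-inverseʳ μ | xor-identityʳ (team P μ <ᵇ team P (not μ))
    with early P | μ
  ... | true  | false = trans (<ᵇ-true (team-false<team-true P))
                              (sym (trans (hapBreakingAt-team (2 * P + 1 + bit false) P true)
                                          (cong (false xor_) (≤ᵇ-true (≤-reflexive (+-identityʳ (2 * P + 1)))))))
  ... | true  | true  = trans (<ᵇ-false (<⇒≤ (team-false<team-true P)))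
                              (sym (trans (hapBreakingAt-team (2 * P + 1 + bit true) P true)
                                          (cong (false xor_) (≤ᵇ-false (m<m+n (2 * P + 1) (s≤s z≤n))))))
  ... | false | false = trans (<ᵇ-true (team-false<team-true P))
                              (sym (trans (hapBreakingAt-team (2 * P + bit true) P false)
                                          (cong (true xor_) (≤ᵇ-false (team-false<team-true P)))))
  ... | false | true  = trans (<ᵇ-false (<⇒≤ (team-false<team-true P)))
                              (sym (trans (hapBreakingAt-team (2 * P + bit false) P false)
                                          (cong (true xor_) (≤ᵇ-true (≤-refl {2 * P + 0})))))
  hosts-slot {P} {μ} P≤a _ (toApex P≢a)
    rewrite slot-toApex {P} {μ} P≢a (not-¬ refl) | hosts-team P μ apex (not μ) | xor-inverseʳ μ
          | <ᵇ-true (team-< μ (not μ) (≤∧≢⇒< P≤a P≢a))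
    with early P
  ... | true  = sym (trans (hapBreakingAt-team (2 * P + 1 + bit μ) P false)
                           (cong (true xor_) (≤ᵇ-false (<-≤-trans (team-false<team-true P) (m≤m+n (2 * P + 1) (bit μ))))))
  ... | false = sym (trans (hapBreakingAt-team (2 * P + bit (not μ)) P true)
                           (cong (false xor_) (≤ᵇ-true (+-monoʳ-≤ (2 * P) (bit≤1 (not μ))))))
  hosts-slot {μ = μ} {Q} _ Q≤a (fromApex Q≢a)
    rewrite slot-fromApex {μ} Q≢a (not-¬ refl) | hosts-team apex μ Q (not μ) | xor-inverseʳ μ
          | <ᵇ-false (<⇒≤ (team-< (not μ) μ (≤∧≢⇒< Q≤a Q≢a)))
          | early-false {apex} K<apex = sym (begin
    hapBreakingAt (team apex (not μ)) (apexSlot Q)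
      ≡⟨ hapBreakingAt-below (<-≤-trans (apexSlot<4K+2 (≤∧≢⇒< Q≤a Q≢a)) 4K+2≤) ⟩
    even (apexSlot Q)                                ≡⟨ cong even (apexSlot-team Q) ⟩
    even (if early Q then _ else _)                  ≡⟨ apexSlot-odd (early Q) ⟩
    false                                            ∎)
    where
    open ≡-Reasoning
    4K+2≤ : 4 * K + 2 ≤ team apex (not μ)
    4K+2≤ = ≤-trans (≤-reflexive (sym team-apex)) (+-monoʳ-≤ (2 * apex) z≤n)
    apexSlot-odd : ∀ c → even (if c then team (team Q false) true else team (team (Q ∸ suc K) true) true) ≡ false
    apexSlot-odd true  = even-2*+bit (team Q false) true
    apexSlot-odd false = even-2*+bit (team (Q ∸ suc K) true) true
  hosts-slot {P} {μ} {Q} {ν} _ _ (plain Q≢P cond)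
    rewrite slot-plain Q≢P cond | hosts-team P μ Q ν | team-<ᵇ μ ν Q≢P
          | hapBreakingAt-team (breakOf P μ) Q (μ xor ν) | breakOf-≤ᵇ μ (μ xor ν) Q≢P = xor-comm (P <ᵇ Q) (not (μ xor ν))

  breakOf≤m : ∀ {P} μ → P ≤ apex → breakOf P μ ≤ m
  breakOf≤m {P} μ P≤a with P ≤? K
  ... | yes P≤K rewrite early-true P≤K = begin
    2 * P + 1 + bit μ              ≤⟨ +-mono-≤ (+-monoˡ-≤ 1 (*-monoʳ-≤ 2 P≤K)) (bit≤1 μ) ⟩
    2 * K + 1 + 1                  ≤⟨ m≤m+n (2 * K + 1 + 1) (2 * K + 1) ⟩
    2 * K + 1 + 1 + (2 * K + 1)    ≡⟨ solve (K ∷ []) ⟩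
    4 * K + 3                      ∎
    where open ≤-Reasoning
  ... | no P≰K rewrite early-false (≰⇒> P≰K) = begin
    2 * P + bit (not μ)            ≤⟨ +-mono-≤ (*-monoʳ-≤ 2 P≤a) (bit≤1 (not μ)) ⟩
    2 * (2 * K + 1) + 1            ≡⟨ solve (K ∷ []) ⟩
    4 * K + 3                      ∎
    where open ≤-Reasoning

  ⌊/2⌋≤apex : ∀ {x} → x < 4 * suc K → ⌊ x /2⌋ ≤ apex
  ⌊/2⌋≤apex {x} x<n = ≤-pred (subst (⌊ x /2⌋ <_) (arith K) (*-cancelˡ-< 2 ⌊ x /2⌋ (2 * K + 2) 2P<2[2K+2]))
    where
    arith : ∀ K → 2 * K + 2 ≡ suc (2 * K + 1)
    arith = solve-∀
    n≡ : ∀ K → 4 * suc K ≡ 2 * (2 * K + 2)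
    n≡ = solve-∀
    2P<2[2K+2] : 2 * ⌊ x /2⌋ < 2 * (2 * K + 2)
    2P<2[2K+2] = ≤-<-trans (≤-trans (m≤m+n (2 * ⌊ x /2⌋) (bit (odd x))) (≤-reflexive (team-⌊/2⌋ x)))
                           (subst (x <_) (n≡ K) x<n)

  2*≤m : ∀ {P} → P ≤ apex → 2 * P ≤ m
  2*≤m {P} P≤a = ≤-trans (*-monoʳ-≤ 2 P≤a) (≤-trans (m≤m+n (2 * apex) 1) (≤-reflexive (arith K)))
    where
    arith : ∀ K → 2 * (2 * K + 1) + 1 ≡ 4 * K + 3
    arith = solve-∀

  opponent : ∀ {x y} → x ≢ y → Opponent ⌊ x /2⌋ (odd x) ⌊ y /2⌋ (odd y)
  opponent {x} {y} x≢y = classify _ _ _ _ λ eq →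
    x≢y (trans (sym (team-⌊/2⌋ x)) (trans (cong₂ team (cong proj₁ eq) (cong proj₂ eq)) (team-⌊/2⌋ y)))

  roundℕ : ℕ → ℕ → ℕ
  roundℕ x y = (2 * ⌊ x /2⌋ + slot ⌊ x /2⌋ (odd x) ⌊ y /2⌋ (odd y)) % m

  roundℕ-sym : ∀ {x y} → x < 4 * suc K → y < 4 * suc K → x ≢ y → roundℕ x y ≡ roundℕ y x
  roundℕ-sym x<n y<n x≢y = slot-sym (⌊/2⌋≤apex x<n) (⌊/2⌋≤apex y<n) (opponent x≢y)

  relative-roundℕ : ∀ {x y} → x < 4 * suc K → y < 4 * suc K → x ≢ y →
                    relative (2 * ⌊ x /2⌋) (roundℕ x y) ≡ slot ⌊ x /2⌋ (odd x) ⌊ y /2⌋ (odd y)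
  relative-roundℕ x<n y<n x≢y =
    relative-+ _ (2*≤m (⌊/2⌋≤apex x<n)) (slot<m (⌊/2⌋≤apex x<n) (⌊/2⌋≤apex y<n) (opponent x≢y))

  opponentInRound : ℕ → ℕ → ℕ
  opponentInRound x t = uncurry team (opponentAt ⌊ x /2⌋ (odd x) (relative (2 * ⌊ x /2⌋) t))

  opponentInRound-roundℕ : ∀ {x y} → x < 4 * suc K → y < 4 * suc K → x ≢ y → opponentInRound x (roundℕ x y) ≡ y
  opponentInRound-roundℕ {x} {y} x<n y<n x≢y = begin
    uncurry team (opponentAt P μ (relative (2 * P) (roundℕ x y)))
      ≡⟨ cong (uncurry team ∘ opponentAt P μ) (relative-roundℕ x<n y<n x≢y) ⟩
    uncurry team (opponentAt P μ (slot P μ ⌊ y /2⌋ (odd y)))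
      ≡⟨ cong (uncurry team) (opponentAt-slot (⌊/2⌋≤apex x<n) (⌊/2⌋≤apex y<n) (opponent x≢y)) ⟩
    team ⌊ y /2⌋ (odd y)
      ≡⟨ team-⌊/2⌋ y ⟩
    y ∎
    where
    open ≡-Reasoning
    P = ⌊ x /2⌋
    μ = odd x

  venueOf : ℕ → ℕ → Bool
  venueOf x = hapBreakingAt (breakOf ⌊ x /2⌋ (odd x)) ∘ relative (2 * ⌊ x /2⌋)

  hosts-roundℕ : ∀ {x y} → x < 4 * suc K → y < 4 * suc K → x ≢ y → hosts x y ≡ venueOf x (roundℕ x y)
  hosts-roundℕ {x} {y} x<n y<n x≢y = begin
    hosts x y                                   ≡⟨ sym (cong₂ hosts (team-⌊/2⌋ x) (team-⌊/2⌋ y)) ⟩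
    hosts (team P μ) (team ⌊ y /2⌋ (odd y))     ≡⟨ hosts-slot (⌊/2⌋≤apex x<n) (⌊/2⌋≤apex y<n) (opponent x≢y) ⟩
    hapBreakingAt b (slot P μ ⌊ y /2⌋ (odd y))  ≡⟨ cong (hapBreakingAt b) (sym (relative-roundℕ x<n y<n x≢y)) ⟩
    venueOf x (roundℕ x y)                      ∎
    where
    open ≡-Reasoning
    P = ⌊ x /2⌋
    μ = odd x
    b = breakOf P μ

  breakRound : ℕ → ℕ
  breakRound x = (2 * ⌊ x /2⌋ + breakOf ⌊ x /2⌋ (odd x) % m) % m

  venueOf-breaks : ∀ {x} → x < 4 * suc K → BreaksExactlyAt m (venueOf x) (breakRound x)
  venueOf-breaks {x} x<n =
    rotate-breaks (2*≤m (⌊/2⌋≤apex x<n)) (m%n<n _ m)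
      (hapBreakingAt-breaks even[pred-m] (breakOf≤m (odd x) (⌊/2⌋≤apex x<n)))
    where
    arith : ∀ K → 4 * K + 3 ≡ suc (2 * (2 * K + 1))
    arith = solve-∀
    even[pred-m] : even (pred m) ≡ true
    even[pred-m] = trans (cong (even ∘ pred) (arith K)) (even-2* (2 * K + 1))

  m≡rounds : m ≡ 4 * suc K ∸ 1
  m≡rounds = arith K
    where
    arith : ∀ K → 4 * K + 3 ≡ K + 3 * suc K
    arith = solve-∀

  schedule : Schedule (4 * suc K)
  schedule = record
    { round = λ i j → fromℕ< (subst (roundℕ (toℕ i) (toℕ j) <_) m≡rounds (m%n<n _ m))
    ; home  = λ i j → hosts (toℕ i) (toℕ j)
    }

  toℕ-round : ∀ i j → toℕ (round schedule i j) ≡ roundℕ (toℕ i) (toℕ j)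
  toℕ-round i j = toℕ-fromℕ< _

  wellFormed : WellFormed schedule
  wellFormed i j i≢j =
    toℕ-injective (trans (toℕ-round i j) (trans (roundℕ-sym (toℕ<n i) (toℕ<n j) (toℕ-≢ i≢j)) (sym (toℕ-round j i)))) ,
    hosts-flip (toℕ-≢ i≢j)

  opponentInjective : OpponentInjective schedule
  opponentInjective i j j′ j≢i j′≢i same-round = toℕ-injective (begin
    toℕ j                                               ≡⟨ sym (opponentInRound-roundℕ (toℕ<n i) (toℕ<n j) (toℕ-≢ (j≢i ∘ sym))) ⟩
    opponentInRound (toℕ i) (roundℕ (toℕ i) (toℕ j))    ≡⟨ cong (opponentInRound (toℕ i)) same-roundℕ ⟩
    opponentInRound (toℕ i) (roundℕ (toℕ i) (toℕ j′))   ≡⟨ opponentInRound-roundℕ (toℕ<n i) (toℕ<n j′) (toℕ-≢ (j′≢i ∘ sym)) ⟩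
    toℕ j′                                              ∎)
    where
    open ≡-Reasoning
    same-roundℕ : roundℕ (toℕ i) (toℕ j) ≡ roundℕ (toℕ i) (toℕ j′)
    same-roundℕ = trans (sym (toℕ-round i j)) (trans (cong toℕ same-round) (toℕ-round i j′))

  singleBreak-schedule : SingleBreak schedule
  singleBreak-schedule = singleBreak schedule λ i →
    breakRound (toℕ i) , subst (breakRound (toℕ i) <_) m≡rounds (m%n<n _ m) ,
    subst (λ n → BreaksExactlyAt n (venue schedule i) (breakRound (toℕ i))) m≡rounds
      (BreaksExactlyAt-cong (λ t t<m → venue≡venueOf i t (subst (t <_) m≡rounds t<m)) (venueOf-breaks (toℕ<n i)))
    where
    venue≡venueOf : ∀ i t → t < 4 * suc K ∸ 1 → venue schedule i t ≡ venueOf (toℕ i) t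
    venue≡venueOf = venue-from-rounds schedule (venueOf ∘ toℕ) opponentInjective λ i j j≢i →
      trans (hosts-roundℕ (toℕ<n i) (toℕ<n j) (toℕ-≢ (j≢i ∘ sym))) (cong (venueOf (toℕ i)) (sym (toℕ-round i j)))

theorem1 : (k : ℕ) → 1 ≤ k →
    Σ (Schedule (4 * k)) (λ s → WellFormed s × Feasible s × SingleBreak s × RankingFair s)
theorem1 (suc K) _ =
  schedule , wellFormed , feasible schedule opponentInjective , singleBreak-schedule , rankingFair schedule (λ _ _ → refl)
  where open Construction K
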